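{- Any map of presheaves $\tau:\Gamma\to\Theta$ from a discrete bridge/path cubical set $\Gamma$ to an arbitrary bridge/path cubical set $\Theta$ factors uniquely over $\kappa:\flat\Theta\to\Theta$. Hence the shape quotient functor $\Gamma\mapsto\Gamma/\mathrm{SE}$ is left adjoint to $\flat$ on bridge/path cubical sets.
   Context: $\mathrm{BPCube}$: pairs $W=(W_B,W_P)$ of disjoint finite sets of names; face maps assign to bridge variables values in $\{0,1\}\cup V_B$ and to path variables values in $\{0,1\}\cup V_B\cup V_P$; composition by substitution. $\natural W:=(W_B,\emptyset)$ with $i\langle\natural\varphi\rangle=i\langle\varphi\rangle$; $\varsigma_W:W\to\natural W$ sends each bridge variable to itself; $\flat\Gamma:=\Gamma\circ\natural$, $\kappa_{\Gamma,W}:=\Gamma(\varsigma_W)$. For a fresh path variable $i$, $(\setminus i):(W,i{:}\mathbb P)\to W$ is the weakening and $(0/i):W\to(W,i{:}\mathbb P)$ sends $i$ to $0$ and other variables to themselves. $\Gamma$ is discrete if every $\gamma\in\Gamma(W,i{:}\mathbb P)$ equals $\gamma'(\setminus i)$ for some $\gamma'$. The shape equivalence relation $\mathrm{SE}$ on $\Gamma$ is the least family of equivalence relations on the sets $\Gamma(W)$, stable under restriction, with $\gamma\sim\gamma(0/i)(\setminus i)$ for all $\gamma\in\Gamma(W,i{:}\mathbb P)$; the shape quotient is the levelwise quotient presheaf $\Gamma/\mathrm{SE}$, acting on maps in the induced way. -}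

module Defs where

open import Data.Nat using (ℕ; zero; suc)
open import Data.Fin using (Fin; zero; suc)
open import Data.Vec using (Vec; []; _∷_; map; lookup; tabulate)
open import Data.Vec.Properties using (map-id; map-cong; lookup∘tabulate; tabulate∘lookup; tabulate-∘)
open import Data.Product using (Σ; _×_; _,_; proj₁; proj₂)
open import Function using (_∘_)
open import Relation.Binary.PropositionalEquality
  using (_≡_; refl; sym; trans; cong; cong₂)

-- An object W = (W_B , W_P) is given by the numbers of bridge and path
-- variables; the variables are  Fin nB  resp.  Fin nP  (names up to
-- renaming, so the two sets are automatically disjoint and finite).

record Ctx : Set where
  constructor _⨾_
  field
    nB : ℕ
    nP : ℕ
open Ctx public

data BVal (n : ℕ) : Set where
  b0 b1 : BVal n
  bv    : Fin n → BVal n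

data PVal (W : Ctx) : Set where
  p0 p1 : PVal W
  pb    : Fin (nB W) → PVal W
  pp    : Fin (nP W) → PVal W

-- A face map  φ : W → V  assigns to every bridge variable of V a value in
-- {0,1} ∪ W_B and to every path variable of V a value in {0,1} ∪ W_B ∪ W_P
-- (so that presheaves Γ act contravariantly:  Γ(V) → Γ(W)).
Hom : Ctx → Ctx → Set
Hom W V = Vec (BVal (nB W)) (nB V) × Vec (PVal W) (nP V)

bToP : ∀ {W} → BVal (nB W) → PVal W
bToP b0     = p0
bToP b1     = p1
bToP (bv k) = pb k

substB : ∀ {m n} → Vec (BVal m) n → BVal n → BVal m
substB σ b0     = b0
substB σ b1     = b1
substB σ (bv k) = lookup σ k

substP : ∀ {U W} → Hom U W → PVal W → PVal U
substP φ p0     = p0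
substP φ p1     = p1
substP φ (pb k) = bToP (lookup (proj₁ φ) k)
substP φ (pp k) = lookup (proj₂ φ) k

_∘H_ : ∀ {U W V} → Hom W V → Hom U W → Hom U V
ψ ∘H φ = map (substB (proj₁ φ)) (proj₁ ψ) , map (substP φ) (proj₂ ψ)

idH : ∀ {W} → Hom W W
idH = tabulate bv , tabulate pp

♮ : Ctx → Ctx
♮ W = nB W ⨾ 0

♮H : ∀ {W V} → Hom W V → Hom (♮ W) (♮ V)
♮H φ = proj₁ φ , []

ς : (W : Ctx) → Hom W (♮ W)
ς W = tabulate bv , []

-- extension by a fresh path variable i (represented as the variable zero)
_▸P : Ctx → Ctx
W ▸P = nB W ⨾ suc (nP W)

wkP : ∀ {W} → Hom (W ▸P) W
wkP = tabulate bv , tabulate (pp ∘ suc)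

zeroP : ∀ {W} → Hom W (W ▸P)
zeroP = tabulate bv , (p0 ∷ tabulate pp)

record Presheaf : Set₁ where
  field
    Ob   : Ctx → Set
    rs   : ∀ {W V} → Ob V → Hom W V → Ob W
    rs-id : ∀ {W} (γ : Ob W) → rs γ idH ≡ γ
    rs-∘  : ∀ {U W V} (γ : Ob V) (ψ : Hom W V) (φ : Hom U W) →
            rs γ (ψ ∘H φ) ≡ rs (rs γ ψ) φ
open Presheaf public

record _⇒_ (Γ Θ : Presheaf) : Set where
  field
    fun : ∀ {W} → Ob Γ W → Ob Θ W
    nat : ∀ {W V} (γ : Ob Γ V) (φ : Hom W V) →
          fun (rs Γ γ φ) ≡ rs Θ (fun γ) φ
open _⇒_ public

_≈N_ : ∀ {Γ Θ} → Γ ⇒ Θ → Γ ⇒ Θ → Set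
_≈N_ {Γ} σ τ = ∀ {W} (γ : Ob Γ W) → fun σ γ ≡ fun τ γ

_∘N_ : ∀ {Γ Δ Θ} → Δ ⇒ Θ → Γ ⇒ Δ → Γ ⇒ Θ
fun (g ∘N f) = fun g ∘ fun f
nat (g ∘N f) γ φ = trans (cong (fun g) (nat f γ φ)) (nat g (fun f γ) φ)

Discrete : Presheaf → Set
Discrete Γ = ∀ {W} (γ : Ob Γ (W ▸P)) → Σ (Ob Γ W) λ γ' → γ ≡ rs Γ γ' wkP

♭ : Presheaf → Presheaf
Ob (♭ Θ) W = Ob Θ (♮ W)
rs (♭ Θ) γ φ = rs Θ γ (♮H φ)
rs-id (♭ Θ) γ = rs-id Θ γ
rs-∘ (♭ Θ) γ ψ φ = rs-∘ Θ γ (♮H ψ) (♮H φ)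

♭map : ∀ {Θ Θ'} → Θ ⇒ Θ' → ♭ Θ ⇒ ♭ Θ'
fun (♭map g) = fun g
nat (♭map g) γ φ = nat g γ (♮H φ)

substB-id : ∀ {n} (x : BVal n) → substB (tabulate bv) x ≡ x
substB-id b0     = refl
substB-id b1     = refl
substB-id (bv k) = lookup∘tabulate bv k

ς-nat : ∀ {W V} (φ : Hom W V) → ♮H φ ∘H ς W ≡ ς V ∘H φ
ς-nat φ = cong (_, []) (trans (trans (map-cong substB-id (proj₁ φ)) (map-id (proj₁ φ)))
                             (trans (sym (tabulate∘lookup (proj₁ φ)))
                                    (tabulate-∘ (substB (proj₁ φ)) bv)))

κ : (Θ : Presheaf) → ♭ Θ ⇒ Θ
fun (κ Θ) {W} γ = rs Θ γ (ς W)
nat (κ Θ) {W} {V} γ φ =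
  trans (sym (rs-∘ Θ γ (♮H φ) (ς W)))
        (trans (cong (rs Θ γ) (ς-nat φ)) (rs-∘ Θ γ (ς V) φ))

data SE (Γ : Presheaf) : ∀ {W} → Ob Γ W → Ob Γ W → Set where
  se-refl  : ∀ {W} {γ : Ob Γ W} → SE Γ γ γ
  se-sym   : ∀ {W} {γ δ : Ob Γ W} → SE Γ γ δ → SE Γ δ γ
  se-trans : ∀ {W} {γ δ ε : Ob Γ W} → SE Γ γ δ → SE Γ δ ε → SE Γ γ ε
  se-rs    : ∀ {W V} {γ δ : Ob Γ V} (φ : Hom W V) →
             SE Γ γ δ → SE Γ (rs Γ γ φ) (rs Γ δ φ)
  se-gen   : ∀ {W} (γ : Ob Γ (W ▸P)) → SE Γ γ (rs Γ (rs Γ γ zeroP) wkP)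

SE-≡ : ∀ {Γ W} {γ γ' δ δ' : Ob Γ W} → γ ≡ γ' → δ ≡ δ' → SE Γ γ δ → SE Γ γ' δ'
SE-≡ refl refl p = p

≡⇒SE : ∀ {Γ W} {γ δ : Ob Γ W} → γ ≡ δ → SE Γ γ δ
≡⇒SE refl = se-refl

-- Setoid-valued presheaves (needed since Agda has no quotient types)
record SPresheaf : Set₁ where
  field
    SOb    : Ctx → Set
    _≈_    : ∀ {W} → SOb W → SOb W → Set
    ≈-refl  : ∀ {W} {x : SOb W} → x ≈ x
    ≈-sym   : ∀ {W} {x y : SOb W} → x ≈ y → y ≈ x
    ≈-trans : ∀ {W} {x y z : SOb W} → x ≈ y → y ≈ z → x ≈ z
    srs    : ∀ {W V} → SOb V → Hom W V → SOb W
    srs-resp : ∀ {W V} {x y : SOb V} (φ : Hom W V) → x ≈ y → srs x φ ≈ srs y φ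
    srs-id : ∀ {W} (x : SOb W) → srs x idH ≈ x
    srs-∘  : ∀ {U W V} (x : SOb V) (ψ : Hom W V) (φ : Hom U W) →
             srs x (ψ ∘H φ) ≈ srs (srs x ψ) φ
open SPresheaf public

_/SE : Presheaf → SPresheaf
SOb (Γ /SE) = Ob Γ
_≈_ (Γ /SE) = SE Γ
≈-refl (Γ /SE) = se-refl
≈-sym (Γ /SE) = se-sym
≈-trans (Γ /SE) = se-trans
srs (Γ /SE) = rs Γ
srs-resp (Γ /SE) = se-rs
srs-id (Γ /SE) γ = ≡⇒SE (rs-id Γ γ)
srs-∘ (Γ /SE) γ ψ φ = ≡⇒SE (rs-∘ Γ γ ψ φ)

record SMor (P Q : SPresheaf) : Set where
  field
    sfun  : ∀ {W} → SOb P W → SOb Q W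
    sresp : ∀ {W} {x y : SOb P W} → _≈_ P x y → _≈_ Q (sfun x) (sfun y)
    snat  : ∀ {W V} (x : SOb P V) (φ : Hom W V) →
            _≈_ Q (sfun (srs P x φ)) (srs Q (sfun x) φ)
open SMor public

record QHom (P : SPresheaf) (Θ : Presheaf) : Set where
  field
    qfun  : ∀ {W} → SOb P W → Ob Θ W
    qresp : ∀ {W} {x y : SOb P W} → _≈_ P x y → qfun x ≡ qfun y
    qnat  : ∀ {W V} (x : SOb P V) (φ : Hom W V) →
            qfun (srs P x φ) ≡ rs Θ (qfun x) φ
open QHom public

_≈Q_ : ∀ {P Θ} → QHom P Θ → QHom P Θ → Set
_≈Q_ {P} h k = ∀ {W} (x : SOb P W) → qfun h x ≡ qfun k x

_∘QS_ : ∀ {P Q Θ} → QHom Q Θ → SMor P Q → QHom P Θ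
qfun (h ∘QS m) = qfun h ∘ sfun m
qresp (h ∘QS m) p = qresp h (sresp m p)
qnat (h ∘QS m) x φ = trans (qresp h (snat m x φ)) (qnat h (sfun m x) φ)

_∘NQ_ : ∀ {P Θ Θ'} → Θ ⇒ Θ' → QHom P Θ → QHom P Θ'
qfun (g ∘NQ h) = fun g ∘ qfun h
qresp (g ∘NQ h) p = cong (fun g) (qresp h p)
qnat (g ∘NQ h) x φ = trans (cong (fun g) (qnat h x φ)) (nat g (qfun h x) φ)

SE-map : ∀ {Γ Δ} (f : Γ ⇒ Δ) {W} {γ δ : Ob Γ W} → SE Γ γ δ → SE Δ (fun f γ) (fun f δ)
SE-map f se-refl = se-refl
SE-map f (se-sym p) = se-sym (SE-map f p)
SE-map f (se-trans p q) = se-trans (SE-map f p) (SE-map f q)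
SE-map f (se-rs {γ = γ} {δ} φ p) =
  SE-≡ (sym (nat f γ φ)) (sym (nat f δ φ)) (se-rs φ (SE-map f p))
SE-map {Γ} {Δ} f (se-gen γ) =
  SE-≡ refl (sym (trans (nat f (rs Γ γ zeroP) wkP) (cong (λ z → rs Δ z wkP) (nat f γ zeroP))))
       (se-gen (fun f γ))

shapeMap : ∀ {Γ Δ} → Γ ⇒ Δ → SMor (Γ /SE) (Δ /SE)
sfun (shapeMap f) = fun f
sresp (shapeMap f) = SE-map f
snat (shapeMap f) γ φ = ≡⇒SE (nat f γ φ)

-- Everything revolves around the face map  ι W : ♮W → W  which keeps the
-- bridge variables and sends every path variable to 0.  It is a section
-- of ς W (ς W ∘ ι W = id), so restricting along ι undoes κ.  Conversely,
-- in every presheaf Γ each γ is shape equivalent to its path-zeroing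
-- γ⟨ι⟩⟨ς⟩ (induction on the number of path variables, using one
-- generating step  γ ∼ γ(0/i)(\i)  per variable).
--
-- From these two facts we build the adjunction  Φ h := h ∘ (−)⟨ι⟩  and
-- Ψ k := κ ∘ k,  and check that they are mutually inverse and natural.
-- Part (1) is then a corollary: for discrete Γ every τ : Γ → Θ is
-- constant on the generating relation, hence descends to Γ/SE; the
-- factorisation is Φ τ, and uniqueness comes from Φ ∘ Ψ = id.
module Submission where

open import Defs
open import Data.Product using (Σ; _×_; _,_; proj₁; proj₂)
open import Data.Nat using (suc)
import Data.Fin as Fin
open import Data.Vec using (Vec; []; _∷_; map; tabulate; replicate)
open import Data.Vec.Properties using (tabulate∘lookup; tabulate-∘)
open import Function using (_∘_)
open import Relation.Binary.PropositionalEquality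
  using (_≡_; refl; sym; trans; cong; cong₂; module ≡-Reasoning)

substB-tabulate : ∀ {m n} (v : Vec (BVal m) n) → map (substB v) (tabulate bv) ≡ v
substB-tabulate v = trans (sym (tabulate-∘ (substB v) bv)) (tabulate∘lookup v)

substP-tabulate : ∀ {U W} (ψ : Hom U W) → map (substP ψ) (tabulate pp) ≡ proj₂ ψ
substP-tabulate ψ = trans (sym (tabulate-∘ (substP ψ) pp)) (tabulate∘lookup (proj₂ ψ))

ς-∘H : ∀ {W V} (ψ : Hom W V) → ς V ∘H ψ ≡ (proj₁ ψ , [])
ς-∘H ψ = cong (_, []) (substB-tabulate (proj₁ ψ))

wkP-∘H-zeroP : ∀ {W} → wkP {W} ∘H zeroP ≡ idH
wkP-∘H-zeroP = cong₂ _,_ (substB-tabulate (tabulate bv))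
                         (trans (sym (tabulate-∘ (substP zeroP) (pp ∘ Fin.suc)))
                                (tabulate∘lookup (tabulate pp)))

ι : (W : Ctx) → Hom (♮ W) W
ι W = tabulate bv , replicate (nP W) p0

zeroP-∘H-ι : ∀ {W} → zeroP {W} ∘H ι W ≡ ι (W ▸P)
zeroP-∘H-ι {W} = cong₂ _,_ (substB-tabulate (tabulate bv))
                           (cong (p0 ∷_) (substP-tabulate (ι W)))

module _ (Θ : Presheaf) where

  rs-rs : ∀ {U W V} (x : Ob Θ V) {ψ : Hom W V} {φ : Hom U W} {χ : Hom U V} →
          ψ ∘H φ ≡ χ → rs Θ (rs Θ x ψ) φ ≡ rs Θ x χ
  rs-rs x {ψ} {φ} eq = trans (sym (rs-∘ Θ x ψ φ)) (cong (rs Θ x) eq)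

  κ-ι : ∀ {V} (x : Ob Θ (♮ V)) → rs Θ (rs Θ x (ς V)) (ι V) ≡ x
  κ-ι {V} x = trans (rs-rs x (ς-∘H (ι V))) (rs-id Θ x)

  κ-φ-ι : ∀ {W V} (x : Ob Θ (♮ V)) (φ : Hom W V) →
          rs Θ (rs Θ (rs Θ x (ς V)) φ) (ι W) ≡ rs Θ x (♮H φ)
  κ-φ-ι {W} x φ = trans (cong (λ z → rs Θ z (ι W)) (sym (nat (κ Θ) x φ)))
                        (κ-ι (rs Θ x (♮H φ)))

  κ-gen-invariant : ∀ {W} (x : Ob Θ (♮ W)) →
                    rs Θ (rs Θ (rs Θ x (ς (W ▸P))) zeroP) wkP ≡ rs Θ x (ς (W ▸P))
  κ-gen-invariant {W} x = begin
    rs Θ (rs Θ (rs Θ x (ς (W ▸P))) zeroP) wkP ≡⟨ cong (λ z → rs Θ z wkP) (rs-rs x (ς-∘H zeroP)) ⟩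
    rs Θ (rs Θ x (ς W)) wkP                   ≡⟨ rs-rs x (ς-∘H wkP) ⟩
    rs Θ x (ς (W ▸P))                         ∎
    where open ≡-Reasoning

module _ (Γ : Presheaf) where

  SE-zeroing : ∀ {W} (γ : Ob Γ W) → SE Γ γ (rs Γ (rs Γ γ (ι W)) (ς W))
  SE-zeroing {b ⨾ 0} γ = ≡⇒SE (sym (trans (rs-id Γ _) (rs-id Γ γ)))
  SE-zeroing {W@(b ⨾ suc n)} γ =
    se-trans (se-gen γ) (SE-≡ refl zeroing-step (se-rs wkP (SE-zeroing δ)))
    where
      δ : Ob Γ (b ⨾ n)
      δ = rs Γ γ zeroP
      zeroing-step : rs Γ (rs Γ (rs Γ δ (ι (b ⨾ n))) (ς (b ⨾ n))) wkP
                     ≡ rs Γ (rs Γ γ (ι W)) (ς W)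
      zeroing-step = begin
        rs Γ (rs Γ (rs Γ δ (ι (b ⨾ n))) (ς (b ⨾ n))) wkP ≡⟨ rs-rs Γ _ (ς-∘H wkP) ⟩
        rs Γ (rs Γ δ (ι (b ⨾ n))) (ς W)                  ≡⟨ cong (λ z → rs Γ z (ς W)) (rs-rs Γ γ zeroP-∘H-ι) ⟩
        rs Γ (rs Γ γ (ι W)) (ς W)                        ∎
        where open ≡-Reasoning

  ι-nat-SE : ∀ {W V} (γ : Ob Γ V) (φ : Hom W V) →
             SE Γ (rs Γ (rs Γ γ φ) (ι W)) (rs Γ (rs Γ γ (ι V)) (♮H φ))
  ι-nat-SE {W} {V} γ φ =
    SE-≡ refl (κ-φ-ι Γ (rs Γ γ (ι V)) φ) (se-rs (ι W) (se-rs φ (SE-zeroing γ)))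

  SE-respect : ∀ {Θ} (g : Γ ⇒ Θ) →
    (∀ {W} (γ : Ob Γ (W ▸P)) → fun g γ ≡ fun g (rs Γ (rs Γ γ zeroP) wkP)) →
    ∀ {W} {γ δ : Ob Γ W} → SE Γ γ δ → fun g γ ≡ fun g δ
  SE-respect g gen se-refl = refl
  SE-respect g gen (se-sym p) = sym (SE-respect g gen p)
  SE-respect g gen (se-trans p q) = trans (SE-respect g gen p) (SE-respect g gen q)
  SE-respect {Θ} g gen (se-rs {γ = γ} {δ} φ p) =
    trans (nat g γ φ) (trans (cong (λ z → rs Θ z φ) (SE-respect g gen p)) (sym (nat g δ φ)))
  SE-respect g gen (se-gen γ) = gen γ

Φ : ∀ {Γ Θ} → QHom (Γ /SE) Θ → Γ ⇒ ♭ Θ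
fun (Φ {Γ} h) {W} γ = qfun h (rs Γ γ (ι W))
nat (Φ {Γ} h) {W} {V} γ φ =
  trans (qresp h (ι-nat-SE Γ γ φ)) (qnat h (rs Γ γ (ι V)) (♮H φ))

-- a map into ♭Θ transposes to κ ∘ k; it respects SE because elements in the
-- image of κ are fixed by the generating relation
Ψ : ∀ {Γ Θ} → Γ ⇒ ♭ Θ → QHom (Γ /SE) Θ
qfun (Ψ {Θ = Θ} k) = fun (κ Θ ∘N k)
qresp (Ψ {Γ} {Θ} k) = SE-respect Γ (κ Θ ∘N k) κk-gen
  where
    κk-gen : ∀ {W} (γ : Ob Γ (W ▸P)) →
             fun (κ Θ ∘N k) γ ≡ fun (κ Θ ∘N k) (rs Γ (rs Γ γ zeroP) wkP)
    κk-gen γ = sym (trans (nat (κ Θ ∘N k) (rs Γ γ zeroP) wkP)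
                   (trans (cong (λ z → rs Θ z wkP) (nat (κ Θ ∘N k) γ zeroP))
                          (κ-gen-invariant Θ (fun k γ))))
qnat (Ψ {Θ = Θ} k) = nat (κ Θ ∘N k)

Φ-resp : ∀ {Γ Θ} {h h' : QHom (Γ /SE) Θ} → h ≈Q h' → Φ {Γ} {Θ} h ≈N Φ h'
Φ-resp {Γ} e {W} γ = e (rs Γ γ (ι W))

-- Ψ ∘ Φ = id, because γ is shape equivalent to its path-zeroing
Ψ∘Φ : ∀ {Γ Θ} (h : QHom (Γ /SE) Θ) → Ψ {Γ} {Θ} (Φ h) ≈Q h
Ψ∘Φ {Γ} h {W} γ = trans (sym (qnat h (rs Γ γ (ι W)) (ς W))) (qresp h (se-sym (SE-zeroing Γ γ)))

-- Φ ∘ Ψ = id, because ς ∘ ι = id on ♮W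
Φ∘Ψ : ∀ {Γ Θ} (k : Γ ⇒ ♭ Θ) → Φ {Γ} {Θ} (Ψ k) ≈N k
Φ∘Ψ {Θ = Θ} k {W} γ = trans (rs-id Θ _) (trans (nat k γ (ι W)) (rs-id Θ (fun k γ)))

Φ-natural-Γ : ∀ {Γ Γ' Θ} (f : Γ' ⇒ Γ) (h : QHom (Γ /SE) Θ) →
              Φ {Γ'} {Θ} (h ∘QS shapeMap f) ≈N (Φ h ∘N f)
Φ-natural-Γ f h {W} γ = cong (qfun h) (nat f γ (ι W))

Φ-natural-Θ : ∀ {Γ Θ Θ'} (g : Θ ⇒ Θ') (h : QHom (Γ /SE) Θ) →
              Φ {Γ} {Θ'} (g ∘NQ h) ≈N (♭map {Θ} g ∘N Φ h)
Φ-natural-Θ g h γ = refl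

discrete-gen : ∀ {Γ} → Discrete Γ → ∀ {W} (γ : Ob Γ (W ▸P)) → γ ≡ rs Γ (rs Γ γ zeroP) wkP
discrete-gen {Γ} d γ with d γ
... | γ' , refl = cong (λ z → rs Γ z wkP) (sym (trans (rs-rs Γ γ' wkP-∘H-zeroP) (rs-id Γ γ')))

descend : ∀ {Γ Θ} → Discrete Γ → Γ ⇒ Θ → QHom (Γ /SE) Θ
qfun (descend d τ) = fun τ
qresp (descend {Γ} d τ) = SE-respect Γ τ (cong (fun τ) ∘ discrete-gen {Γ} d)
qnat (descend d τ) = nat τ

-- Part (1): σ := Φ τ satisfies κ ∘ σ = Ψ (Φ τ) = τ, and any σ' with
-- κ ∘ σ' = τ, i.e. Ψ σ' = τ, equals Φ (Ψ σ') = Φ τ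
discrete-factorisation : (Γ Θ : Presheaf) → Discrete Γ → (τ : Γ ⇒ Θ) →
  Σ (Γ ⇒ ♭ Θ) λ σ → ((κ Θ ∘N σ) ≈N τ)
    × ((σ' : Γ ⇒ ♭ Θ) → (κ Θ ∘N σ') ≈N τ → σ' ≈N σ)
discrete-factorisation Γ Θ d τ =
  Φ τ̂ , Ψ∘Φ τ̂ , unique
  where
    τ̂ : QHom (Γ /SE) Θ
    τ̂ = descend d τ

    unique : (σ' : Γ ⇒ ♭ Θ) → (κ Θ ∘N σ') ≈N τ → σ' ≈N Φ τ̂
    unique σ' κσ'≈τ γ =
      trans (sym (Φ∘Ψ {Γ} {Θ} σ' γ)) (Φ-resp {h = Ψ {Γ} {Θ} σ'} {h' = τ̂} κσ'≈τ γ)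

lemma4p29 :
    ((Γ Θ : Presheaf) → Discrete Γ → (τ : Γ ⇒ Θ) →
      Σ (Γ ⇒ ♭ Θ) λ σ → ((κ Θ ∘N σ) ≈N τ)
        × ((σ' : Γ ⇒ ♭ Θ) → (κ Θ ∘N σ') ≈N τ → σ' ≈N σ))
    ×
    (Σ (∀ {Γ Θ} → QHom (Γ /SE) Θ → Γ ⇒ ♭ Θ) λ Φ →
     Σ (∀ {Γ Θ} → Γ ⇒ ♭ Θ → QHom (Γ /SE) Θ) λ Ψ →
       (∀ {Γ Θ} (h : QHom (Γ /SE) Θ) → Ψ {Γ} {Θ} (Φ {Γ} {Θ} h) ≈Q h)
     × (∀ {Γ Θ} (k : Γ ⇒ ♭ Θ) → Φ {Γ} {Θ} (Ψ {Γ} {Θ} k) ≈N k)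
     × (∀ {Γ Γ' Θ} (f : Γ' ⇒ Γ) (h : QHom (Γ /SE) Θ) →
          Φ {Γ'} {Θ} (h ∘QS shapeMap f) ≈N (Φ {Γ} {Θ} h ∘N f))
     × (∀ {Γ Θ Θ'} (g : Θ ⇒ Θ') (h : QHom (Γ /SE) Θ) →
          Φ {Γ} {Θ'} (g ∘NQ h) ≈N (♭map {Θ} {Θ'} g ∘N Φ {Γ} {Θ} h)))
lemma4p29 = discrete-factorisation , Φ , Ψ , Ψ∘Φ , (λ {Γ} {Θ} → Φ∘Ψ {Γ} {Θ}) , Φ-natural-Γ , Φ-natural-Θ
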